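{- Let $U=U(P,Q)$ be a $\Delta$-regular Lucas sequence. Let $p>3$ be a prime with $p\nmid Q$ and $\rho_U(p)=p+1$. If there exists a prime $q\nmid Q$ with $\rho_U(q)=p$, then for every integer $j\geq0$ the number \[ C_{U,p+1}(pq^j-1)=\frac{1}{U_{n+1}^{p+1}}\cdot\frac{((p+2)n)!_U}{(n!_U)^{p+2}},\qquad n=pq^j-1, \] is not an integer.
   Context: For nonzero integers $P,Q$, $U=U(P,Q)$ is defined by $U_0=0$, $U_1=1$, $U_{n+2}=PU_{n+1}-QU_n$; $\Delta=P^2-4Q$. $U$ is $\Delta$-regular if $U_n\neq0$ for all $n\geq1$, $\gcd(P,Q)=1$ and $\Delta\neq0$. For a prime $p\nmid Q$, $\rho_U(p)$ is the least integer $n\geq1$ with $p\mid U_n$. $n!_U=U_n\cdots U_1$, $0!_U=1$. -}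

module Defs where

open import Data.Nat as ℕ using (ℕ; zero; suc)
open import Data.Integer as ℤ using (ℤ; +_; _-_; _*_; _^_)
open import Data.Integer.Divisibility using (_∣_)
open import Data.Integer.GCD using (gcd)
open import Data.Product using (_×_)
open import Relation.Binary.PropositionalEquality using (_≡_; _≢_)
open import Relation.Nullary using (¬_)

U : ℤ → ℤ → ℕ → ℤ
U P Q zero = + 0
U P Q (suc zero) = + 1
U P Q (suc (suc n)) = P * U P Q (suc n) - Q * U P Q n

Δ : ℤ → ℤ → ℤ
Δ P Q = P * P - + 4 * Q

_!U : ℕ → (ℤ → ℤ → ℤ)
(zero !U) P Q = + 1
(suc n !U) P Q = U P Q (suc n) * (n !U) P Q

-- Δ-regular (P, Q nonzero integers as standing assumption)
ΔRegular : ℤ → ℤ → Set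
ΔRegular P Q =
  P ≢ + 0 × Q ≢ + 0 ×
  (∀ n → U P Q (suc n) ≢ + 0) × gcd P Q ≡ + 1 × Δ P Q ≢ + 0

RankIs : ℤ → ℤ → ℕ → ℕ → Set
RankIs P Q p m =
  1 ℕ.≤ m × (+ p) ∣ U P Q m × (∀ k → 1 ℕ.≤ k → k ℕ.< m → ¬ ((+ p) ∣ U P Q k))

CNum : ℤ → ℤ → ℕ → ℕ → ℤ
CNum P Q p n = (((p ℕ.+ 2) ℕ.* n) !U) P Q

CDen : ℤ → ℤ → ℕ → ℕ → ℤ
CDen P Q p n = (U P Q (suc n) ^ (p ℕ.+ 1)) * (((n !U) P Q) ^ (p ℕ.+ 2))

-- C is an integer iff the (nonzero, by regularity) denominator divides the numerator
CIsInteger : ℤ → ℤ → ℕ → ℕ → Set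
CIsInteger P Q p n = CDen P Q p n ∣ CNum P Q p n

module Submission where

-- Write g(k) for the q-adic valuation of U_k. As q has rank p, q ∣ U_k iff p ∣ k, and
-- U_{tm} ≡ t U_m U_{m+1}^{t-1} (mod U_m²) gives g(tm) = g(m) whenever q ∣ U_m and q ∤ t; so g(px)
-- depends only on the q-adic valuation of x. Hence with N = pq^j = n + 1, g(iN + r) = g(r) for
-- 1 ≤ r < N, and g(iN) = g(N) for 1 ≤ i ≤ p + 1, because q ≥ p + 2 (the rank of q is at most
-- q + 1, and p ≠ q, q + 1, q − 1 as p > 3 is a prime of rank p + 1). Summing over blocks of length N,
-- the valuation of the denominator U_{n+1}^{p+1} (n!_U)^{p+2} is g(1) + ⋯ + g((p+1)N + n), whereas
-- that of the numerator ((p+2)n)!_U is g(1) + ⋯ + g((p+2)n), which misses the term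
-- g((p+2)n + 2) = g(p((p+2)q^j − 1)) = g(p) ≥ 1.

open import Data.Nat using (ℕ; suc)
open import Data.Nat.Primality using (Prime)
open import Data.Integer as ℤ using (ℤ)
import Data.Integer.Divisibility.Signed as Signed
open import Relation.Nullary using (¬_)
open import Relation.Binary.PropositionalEquality using (_≢_)
open import Defs

module Valuation {q : ℕ} (q-prime : Prime q) where

  open import Data.Nat
  open import Data.Nat.Properties
  open import Data.Nat.Divisibility
  open import Data.Nat.Primality using (prime⇒nonZero; prime⇒nonTrivial; euclidsLemma)
  open import Data.Integer.Properties using (abs-*; ∣i∣≡0⇒i≡0; i^n≡0⇒i≡0)
  open import Data.Product using (∃; _×_; _,_)
  open import Data.Sum using (inj₁; inj₂; [_,_]′)
  open import Data.Empty using (⊥-elim)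
  open import Function using (_∘_)
  open import Relation.Nullary using (yes; no)
  open import Relation.Binary.PropositionalEquality
  open import Data.Nat.Tactic.RingSolver

  private
    instance
      q-nonZero : NonZero q
      q-nonZero = prime⇒nonZero q-prime

    1<q : 1 < q
    1<q = nonTrivial⇒n>1 q {{prime⇒nonTrivial q-prime}}

  q∤1 : ¬ q ∣ 1
  q∤1 q∣1 = <⇒≢ 1<q (sym (∣1⇒≡1 q∣1))

  private
    ν-fuel : ℕ → ℕ → ℕ
    ν-fuel zero    _ = 0
    ν-fuel (suc f) x with q ∣? x
    ... | yes (divides c _) = suc (ν-fuel f c)
    ... | no  _             = 0

    ν-fuel-decomposition : ∀ f x → x ≢ 0 → x ≤ f → ∃ λ t → x ≡ q ^ ν-fuel f x * t × ¬ q ∣ t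
    ν-fuel-decomposition zero    x x≢0 x≤0 = ⊥-elim (x≢0 (n≤0⇒n≡0 x≤0))
    ν-fuel-decomposition (suc f) x x≢0 x≤1+f with q ∣? x
    ... | no  q∤x = x , sym (*-identityˡ x) , q∤x
    ... | yes (divides c refl) with ν-fuel-decomposition f c c≢0 (<⇒≤pred (<-≤-trans c<c*q x≤1+f))
      where
      c≢0 : c ≢ 0
      c≢0 refl = x≢0 refl
      c<c*q : c < c * q
      c<c*q = m<m*n c q {{≢-nonZero c≢0}} 1<q
    ...   | t , c≡ , q∤t = t , trans (cong (_* q) c≡) (regroup q (q ^ ν-fuel f c) t) , q∤t
      where
      regroup : ∀ q a t → a * t * q ≡ q * a * t
      regroup = solve-∀

  -- Fuel x suffices, since every step divides by q > 1.
  ν : ℕ → ℕ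
  ν x = ν-fuel x x

  ν-decomposition : ∀ {x} → x ≢ 0 → ∃ λ t → x ≡ q ^ ν x * t × ¬ q ∣ t
  ν-decomposition {x} x≢0 = ν-fuel-decomposition x x x≢0 ≤-refl

  q^*-injective : ∀ s s′ {t t′} → q ^ s * t ≡ q ^ s′ * t′ → ¬ q ∣ t → ¬ q ∣ t′ → s ≡ s′
  q^*-injective zero    zero     eq q∤t q∤t′ = refl
  q^*-injective zero    (suc s′) {t} {t′} eq q∤t q∤t′ =
    ⊥-elim (q∤t (subst (q ∣_) (trans (sym eq) (*-identityˡ t)) (∣m⇒∣m*n t′ (m∣m*n (q ^ s′)))))
  q^*-injective (suc s) zero     {t} {t′} eq q∤t q∤t′ =
    ⊥-elim (q∤t′ (subst (q ∣_) (trans eq (*-identityˡ t′)) (∣m⇒∣m*n t (m∣m*n (q ^ s)))))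
  q^*-injective (suc s) (suc s′) {t} {t′} eq q∤t q∤t′ =
    cong suc (q^*-injective s s′ (*-cancelˡ-≡ _ _ q
      (trans (sym (*-assoc q (q ^ s) t)) (trans eq (*-assoc q (q ^ s′) t′)))) q∤t q∤t′)

  ν-≡ : ∀ {x} s t → x ≡ q ^ s * t → ¬ q ∣ t → ν x ≡ s
  ν-≡ {x} s t x≡ q∤t with ν-decomposition x≢0
    where
    x≢0 : x ≢ 0
    x≢0 x≡0 with m*n≡0⇒m≡0∨n≡0 (q ^ s) (trans (sym x≡) x≡0)
    ... | inj₁ q^s≡0 = ≢-nonZero⁻¹ (q ^ s) {{m^n≢0 q s}} q^s≡0
    ... | inj₂ refl  = q∤t (q ∣0)
  ... | t′ , x≡′ , q∤t′ = q^*-injective (ν x) s (trans (sym x≡′) x≡) q∤t′ q∤t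

  ν≡0 : ∀ {x} → ¬ q ∣ x → ν x ≡ 0
  ν≡0 {x} q∤x = ν-≡ 0 x (sym (*-identityˡ x)) q∤x

  ∣⇒ν≥1 : ∀ {x} → x ≢ 0 → q ∣ x → 1 ≤ ν x
  ∣⇒ν≥1 {x} x≢0 q∣x with ν x | ν-decomposition x≢0
  ... | zero  | t , x≡ , q∤t = ⊥-elim (q∤t (subst (q ∣_) (trans x≡ (*-identityˡ t)) q∣x))
  ... | suc _ | _            = s≤s z≤n

  ν-* : ∀ {x y} → x ≢ 0 → y ≢ 0 → ν (x * y) ≡ ν x + ν y
  ν-* {x} {y} x≢0 y≢0 with ν-decomposition x≢0 | ν-decomposition y≢0
  ... | t , x≡ , q∤t | t′ , y≡ , q∤t′ = ν-≡ (ν x + ν y) (t * t′) x*y≡ q∤t*t′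
    where
    x*y≡ : x * y ≡ q ^ (ν x + ν y) * (t * t′)
    x*y≡ = begin
      x * y                              ≡⟨ cong₂ _*_ x≡ y≡ ⟩
      (q ^ ν x * t) * (q ^ ν y * t′)     ≡⟨ interchange (q ^ ν x) t (q ^ ν y) t′ ⟩
      (q ^ ν x * q ^ ν y) * (t * t′)     ≡⟨ cong (_* (t * t′)) (^-distribˡ-+-* q (ν x) (ν y)) ⟨
      q ^ (ν x + ν y) * (t * t′)         ∎
      where
      open ≡-Reasoning
      interchange : ∀ a b c d → (a * b) * (c * d) ≡ (a * c) * (b * d)
      interchange = solve-∀
    q∤t*t′ : ¬ q ∣ t * t′
    q∤t*t′ q∣t*t′ = [ q∤t , q∤t′ ]′ (euclidsLemma t t′ q-prime q∣t*t′)

  ν-mono-∣ : ∀ {x y} → x ∣ y → y ≢ 0 → ν x ≤ ν y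
  ν-mono-∣ {x} {y} (divides c refl) y≢0 = subst (ν x ≤_) (sym (ν-* c≢0 x≢0)) (m≤n+m (ν x) (ν c))
    where
    c≢0 : c ≢ 0
    c≢0 refl = y≢0 refl
    x≢0 : x ≢ 0
    x≢0 refl = y≢0 (*-zeroʳ c)

  ν-+ : ∀ {x y} → y ≢ 0 → q ^ suc (ν y) ∣ x → ν (x + y) ≡ ν y
  ν-+ {x} {y} y≢0 (divides c refl) with ν-decomposition y≢0
  ... | t , y≡ , q∤t = ν-≡ (ν y) (c * q + t) x+y≡ q∤c*q+t
    where
    x+y≡ : c * q ^ suc (ν y) + y ≡ q ^ ν y * (c * q + t)
    x+y≡ = trans (cong (c * q ^ suc (ν y) +_) y≡) (factor q (q ^ ν y) c t)
      where
      factor : ∀ q a c t → c * (q * a) + a * t ≡ a * (c * q + t)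
      factor = solve-∀
    q∤c*q+t : ¬ q ∣ c * q + t
    q∤c*q+t q∣c*q+t = q∤t (∣m+n∣m⇒∣n q∣c*q+t (n∣m*n c))

  ν-*q^+ : ∀ i j {r} → 1 ≤ r → r < q ^ j → ν (i * q ^ j + r) ≡ ν r
  ν-*q^+ i j {r} 1≤r r<q^j = ν-+ r≢0 (∣n⇒∣m*n i q^[1+νr]∣q^j)
    where
    r≢0 : r ≢ 0
    r≢0 = ≢-nonZero⁻¹ r {{>-nonZero 1≤r}}
    q^νr≤r : q ^ ν r ≤ r
    q^νr≤r with ν-decomposition r≢0
    ... | t , r≡ , _ = ∣⇒≤ {{>-nonZero 1≤r}} (divides t (trans r≡ (*-comm _ t)))
    νr<j : ν r < j
    νr<j = ≰⇒> λ j≤νr → <⇒≱ r<q^j (≤-trans (^-monoʳ-≤ q j≤νr) q^νr≤r)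
    q^[1+νr]∣q^j : q ^ suc (ν r) ∣ q ^ j
    q^[1+νr]∣q^j = divides (q ^ (j ∸ suc (ν r)))
      (trans (cong (q ^_) (sym (m∸n+n≡m νr<j))) (^-distribˡ-+-* q (j ∸ suc (ν r)) (suc (ν r))))

  νℤ : ℤ → ℕ
  νℤ x = ν ℤ.∣ x ∣

  private
    abs≢0 : ∀ {x} → x ≢ ℤ.0ℤ → ℤ.∣ x ∣ ≢ 0
    abs≢0 x≢0 ∣x∣≡0 = x≢0 (∣i∣≡0⇒i≡0 ∣x∣≡0)

  νℤ-* : ∀ {x y} → x ≢ ℤ.0ℤ → y ≢ ℤ.0ℤ → νℤ (x ℤ.* y) ≡ νℤ x + νℤ y
  νℤ-* {x} {y} x≢0 y≢0 = trans (cong ν (abs-* x y)) (ν-* (abs≢0 x≢0) (abs≢0 y≢0))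

  νℤ-^ : ∀ {x} e → x ≢ ℤ.0ℤ → νℤ (x ℤ.^ e) ≡ e * νℤ x
  νℤ-^     zero    x≢0 = ν≡0 q∤1
  νℤ-^ {x} (suc e) x≢0 = trans (νℤ-* x≢0 (x≢0 ∘ i^n≡0⇒i≡0 x e)) (cong (νℤ x +_) (νℤ-^ e x≢0))

  νℤ-mono-∣ : ∀ x {y} → ℤ.∣ x ∣ ∣ ℤ.∣ y ∣ → y ≢ ℤ.0ℤ → νℤ x ≤ νℤ y
  νℤ-mono-∣ _ x∣y y≢0 = ν-mono-∣ x∣y (abs≢0 y≢0)

  νℤ-*-∤ : ∀ {x y} → x ≢ ℤ.0ℤ → ¬ q ∣ ℤ.∣ y ∣ → νℤ (x ℤ.* y) ≡ νℤ x
  νℤ-*-∤ {x} {y} x≢0 q∤y = begin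
    νℤ (x ℤ.* y)   ≡⟨ νℤ-* x≢0 y≢0 ⟩
    νℤ x + νℤ y    ≡⟨ cong (νℤ x +_) (ν≡0 q∤y) ⟩
    νℤ x + 0       ≡⟨ +-identityʳ (νℤ x) ⟩
    νℤ x           ∎
    where
    open ≡-Reasoning
    y≢0 : y ≢ ℤ.0ℤ
    y≢0 refl = q∤y (q ∣0)

module Sums where

  open import Data.Nat
  open import Data.Nat.Properties
  open import Relation.Binary.PropositionalEquality

  sumTo : (ℕ → ℕ) → ℕ → ℕ
  sumTo f zero    = 0
  sumTo f (suc n) = sumTo f n + f (suc n)

  sumTo-cong : ∀ {f g} n → (∀ k → 1 ≤ k → k ≤ n → f k ≡ g k) → sumTo f n ≡ sumTo g n
  sumTo-cong zero    f≗g = refl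
  sumTo-cong (suc n) f≗g =
    cong₂ _+_ (sumTo-cong n λ k 1≤k k≤n → f≗g k 1≤k (m≤n⇒m≤1+n k≤n)) (f≗g (suc n) (s≤s z≤n) ≤-refl)

  sumTo-+ : ∀ f m n → sumTo f (m + n) ≡ sumTo f m + sumTo (λ k → f (m + k)) n
  sumTo-+ f m zero    = trans (cong (sumTo f) (+-identityʳ m)) (sym (+-identityʳ _))
  sumTo-+ f m (suc n) rewrite +-suc m n =
    trans (cong (_+ f (suc (m + n))) (sumTo-+ f m n)) (+-assoc (sumTo f m) _ _)

  sumTo-mono-≤ : ∀ f {m n} → m ≤ n → sumTo f m ≤ sumTo f n
  sumTo-mono-≤ f {m} {n} m≤n = begin
    sumTo f m                                    ≤⟨ m≤m+n _ _ ⟩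
    sumTo f m + sumTo (λ k → f (m + k)) (n ∸ m)  ≡⟨ sumTo-+ f m (n ∸ m) ⟨
    sumTo f (m + (n ∸ m))                        ≡⟨ cong (sumTo f) (m+[n∸m]≡n m≤n) ⟩
    sumTo f n                                    ∎
    where open ≤-Reasoning

  sumTo-periodic : ∀ f N c → (∀ i r → i < c → 1 ≤ r → r ≤ N → f (i * N + r) ≡ f r) →
                   ∀ i → i ≤ c → sumTo f (i * N) ≡ i * sumTo f N
  sumTo-periodic f N c periodic zero    _     = refl
  sumTo-periodic f N c periodic (suc i) 1+i≤c = begin
    sumTo f (N + i * N)                              ≡⟨ cong (sumTo f) (+-comm N (i * N)) ⟩
    sumTo f (i * N + N)                              ≡⟨ sumTo-+ f (i * N) N ⟩
    sumTo f (i * N) + sumTo (λ r → f (i * N + r)) N  ≡⟨ cong₂ _+_ (sumTo-periodic f N c periodic i (<⇒≤ 1+i≤c))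
                                                                   (sumTo-cong N (λ r → periodic i r 1+i≤c)) ⟩
    i * sumTo f N + sumTo f N                        ≡⟨ +-comm (i * sumTo f N) _ ⟩
    suc i * sumTo f N                                ∎
    where open ≡-Reasoning

module LucasIdentities (P Q : ℤ) where

  open import Data.Nat as ℕ using (zero)
  import Data.Nat.Properties as ℕ
  open import Data.Integer using (+_; _+_; _*_; _-_; _^_)
  open import Data.Integer.Properties using (*-assoc)
  open import Data.Integer.Divisibility.Signed using (_∣_; divides; ∣-refl; ∣m∣n⇒∣m-n; ∣n⇒∣m*n; ∣m⇒∣m*n)
  open import Data.Product using (∃; _,_)
  open import Relation.Binary.PropositionalEquality
  open import Data.Integer.Tactic.RingSolver

  private
    u : ℕ → ℤ
    u = U P Q

  U-suc-+ : ∀ m n → u (suc (m ℕ.+ n)) ≡ u (suc m) * u (suc n) - Q * u m * u n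
  U-suc-+ zero          n = by-ring Q (u (suc n)) (u n)
    where by-ring : ∀ Q a b → a ≡ + 1 * a - Q * + 0 * b
          by-ring = solve-∀
  U-suc-+ (suc zero)    n = by-ring P Q (u (suc n)) (u n)
    where by-ring : ∀ P Q a b → P * a - Q * b ≡ (P * + 1 - Q * + 0) * a - Q * + 1 * b
          by-ring = solve-∀
  U-suc-+ (suc (suc m)) n = begin
    P * u (suc (suc m ℕ.+ n)) - Q * u (suc (m ℕ.+ n))
      ≡⟨ cong₂ (λ a b → P * a - Q * b) (U-suc-+ (suc m) n) (U-suc-+ m n) ⟩
    P * (u (suc (suc m)) * u (suc n) - Q * u (suc m) * u n) - Q * (u (suc m) * u (suc n) - Q * u m * u n)
      ≡⟨ by-ring P Q (u (suc (suc m))) (u (suc m)) (u m) (u (suc n)) (u n) ⟩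
    (P * u (suc (suc m)) - Q * u (suc m)) * u (suc n) - Q * (P * u (suc m) - Q * u m) * u n ∎
    where
    open ≡-Reasoning
    by-ring : ∀ P Q x y z a b →
      P * (x * a - Q * y * b) - Q * (y * a - Q * z * b) ≡ (P * x - Q * y) * a - Q * (P * y - Q * z) * b
    by-ring = solve-∀

  U-dOcagne : ∀ a d → u (a ℕ.+ d) * u (suc a) - u a * u (suc (a ℕ.+ d)) ≡ Q ^ a * u d
  U-dOcagne zero    d = by-ring (u d) (u (suc d))
    where by-ring : ∀ x y → x * + 1 - + 0 * y ≡ + 1 * x
          by-ring = solve-∀
  U-dOcagne (suc a) d = begin
    u (suc (a ℕ.+ d)) * (P * u (suc a) - Q * u a) - u (suc a) * (P * u (suc (a ℕ.+ d)) - Q * u (a ℕ.+ d))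
      ≡⟨ by-ring P Q (u (suc (a ℕ.+ d))) (u (suc a)) (u a) (u (a ℕ.+ d)) ⟩
    Q * (u (a ℕ.+ d) * u (suc a) - u a * u (suc (a ℕ.+ d)))
      ≡⟨ cong (Q *_) (U-dOcagne a d) ⟩
    Q * (Q ^ a * u d)
      ≡⟨ *-assoc Q (Q ^ a) (u d) ⟨
    Q * Q ^ a * u d ∎
    where
    open ≡-Reasoning
    by-ring : ∀ P Q x y z w → x * (P * y - Q * z) - y * (P * x - Q * w) ≡ Q * (w * y - z * x)
    by-ring = solve-∀

  U-∣-U-* : ∀ k m → u m ∣ u (k ℕ.* m)
  U-∣-U-* k       zero    rewrite ℕ.*-zeroʳ k = ∣-refl
  U-∣-U-* zero    (suc m) = divides (+ 0) refl
  U-∣-U-* (suc k) (suc m) = subst (u (suc m) ∣_) (sym (U-suc-+ m (k ℕ.* suc m)))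
    (∣m∣n⇒∣m-n (∣m⇒∣m*n (u (suc (k ℕ.* suc m))) ∣-refl) (∣n⇒∣m*n (Q * u m) (U-∣-U-* k (suc m))))

  U-suc-* : ∀ k m → ∃ λ Y → u (suc (k ℕ.* m)) ≡ u (suc m) ^ k + u m * Y
  U-suc-* zero    m = + 0 , by-ring (u m)
    where by-ring : ∀ a → + 1 ≡ + 1 + a * + 0
          by-ring = solve-∀
  U-suc-* (suc k) m with U-suc-* k m
  ... | Y , eq = Y * u (suc m) - Q * u (k ℕ.* m) , (begin
    u (suc (m ℕ.+ k ℕ.* m))
      ≡⟨ U-suc-+ m (k ℕ.* m) ⟩
    u (suc m) * u (suc (k ℕ.* m)) - Q * u m * u (k ℕ.* m)
      ≡⟨ cong (λ z → u (suc m) * z - Q * u m * u (k ℕ.* m)) eq ⟩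
    u (suc m) * (u (suc m) ^ k + u m * Y) - Q * u m * u (k ℕ.* m)
      ≡⟨ by-ring (u (suc m)) (u (suc m) ^ k) (u m) Y Q (u (k ℕ.* m)) ⟩
    u (suc m) * u (suc m) ^ k + u m * (Y * u (suc m) - Q * u (k ℕ.* m)) ∎)
    where
    open ≡-Reasoning
    by-ring : ∀ b e a Y Q K → b * (e + a * Y) - Q * a * K ≡ b * e + a * (Y * b - Q * K)
    by-ring = solve-∀

  U-*-expansion : ∀ k m → ∃ λ X →
    u (suc k ℕ.* suc m) ≡ u (suc m) * (+ suc k * u (suc (suc m)) ^ k + u (suc m) * X)
  U-*-expansion zero    m rewrite ℕ.+-identityʳ m = + 0 , by-ring (u (suc m))
    where by-ring : ∀ a → a ≡ a * (+ 1 * + 1 + a * + 0)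
          by-ring = solve-∀
  U-*-expansion (suc k) m with U-*-expansion k m | U-suc-* (suc k) (suc m)
  ... | X , eqX | Y , eqY = Y - P * + suc k * b ^ k - Q * u m * X , (begin
    u (suc (m ℕ.+ K))
      ≡⟨ U-suc-+ m K ⟩
    a * u (suc K) - Q * u m * u K
      ≡⟨ cong₂ (λ x y → a * x - Q * u m * y) eqY eqX ⟩
    a * (b ^ suc k + a * Y) - Q * u m * (a * (+ suc k * b ^ k + a * X))
      ≡⟨ by-ring P Q a (u m) (b ^ k) (+ suc k) X Y ⟩
    a * (+ suc (suc k) * b ^ suc k + a * (Y - P * + suc k * b ^ k - Q * u m * X)) ∎)
    where
    open ≡-Reasoning
    K = suc k ℕ.* suc m
    a = u (suc m)
    b = u (suc (suc m))
    by-ring : ∀ P Q a c e kk X Y →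
      a * ((P * a - Q * c) * e + a * Y) - Q * c * (a * (kk * e + a * X))
      ≡ a * ((+ 1 + kk) * ((P * a - Q * c) * e) + a * (Y - P * kk * e - Q * c * X))
    by-ring = solve-∀

module Congruences where

  open import Data.Nat using (NonZero)
  open import Data.Integer using (+_; _+_; _*_; _-_; 1ℤ)
  open import Data.Integer.DivMod using (_%ℕ_; _/ℕ_; a≡a%ℕn+[a/ℕn]*n)
  open import Data.Integer.Divisibility.Signed using (_∣_; divides; ∣m∣n⇒∣m+n; ∣m∣n⇒∣m-n; ∣n⇒∣m*n)
  open import Relation.Binary.PropositionalEquality
  open import Data.Integer.Tactic.RingSolver

  %ℕ-≡⇒∣- : ∀ {d} .{{_ : NonZero d}} x y → x %ℕ d ≡ y %ℕ d → + d ∣ x - y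
  %ℕ-≡⇒∣- {d} x y x%d≡y%d = divides (x /ℕ d - y /ℕ d) (begin
    x - y
      ≡⟨ cong₂ _-_ (a≡a%ℕn+[a/ℕn]*n x d) (a≡a%ℕn+[a/ℕn]*n y d) ⟩
    + (x %ℕ d) + x /ℕ d * + d - (+ (y %ℕ d) + y /ℕ d * + d)
      ≡⟨ cong (λ r → + (x %ℕ d) + x /ℕ d * + d - (+ r + y /ℕ d * + d)) x%d≡y%d ⟨
    + (x %ℕ d) + x /ℕ d * + d - (+ (x %ℕ d) + y /ℕ d * + d)
      ≡⟨ by-ring (+ (x %ℕ d)) (x /ℕ d) (y /ℕ d) (+ d) ⟩
    (x /ℕ d - y /ℕ d) * + d ∎)
    where
    open ≡-Reasoning
    by-ring : ∀ r a b d → r + a * d - (r + b * d) ≡ (a - b) * d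
    by-ring = solve-∀

  ∣-cross-multiply : ∀ {m x y a b x′ y′} → m ∣ x * a - 1ℤ → m ∣ y * b - 1ℤ → m ∣ x′ * a - y′ * b →
                     m ∣ y * x′ - x * y′
  ∣-cross-multiply {m} {x} {y} {a} {b} {x′} {y′} m∣xa-1 m∣yb-1 m∣x′a-y′b =
    subst (m ∣_) (sym (by-ring x y a b x′ y′))
      (∣m∣n⇒∣m+n (∣m∣n⇒∣m-n (∣n⇒∣m*n (y * x) m∣x′a-y′b) (∣n⇒∣m*n (y * x′) m∣xa-1))
                 (∣n⇒∣m*n (x * y′) m∣yb-1))
    where
    by-ring : ∀ x y a b x′ y′ →
      y * x′ - x * y′ ≡ y * x * (x′ * a - y′ * b) - y * x′ * (x * a - 1ℤ) + x * y′ * (y * b - 1ℤ)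
    by-ring = solve-∀

module IntegerPrime {q : ℕ} (q-prime : Prime q) where

  open import Data.Nat as ℕ using (zero)
  import Data.Nat.Divisibility as ℕ
  open import Data.Nat.Primality using (euclidsLemma; prime⇒irreducible; ¬prime[1])
  open import Data.Nat.Coprimality using (Coprime; coprime-Bézout)
  open import Data.Nat.GCD using (module Bézout)
  open import Data.Integer using (+_; -[1+_]; _+_; _*_; _-_; -_; _^_; 1ℤ) renaming (∣_∣ to abs)
  open import Data.Integer.Properties using (abs-*; pos-*; pos-+)
  open import Data.Integer.Divisibility.Signed using (_∣_; divides; ∣ᵤ⇒∣; ∣⇒∣ᵤ)
  open import Data.Product using (∃; _,_)
  open import Data.Sum using (_⊎_; inj₁; inj₂; [_,_]′; map)
  open import Data.Empty using (⊥-elim)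
  open import Function using (_∘_)
  open import Relation.Binary.PropositionalEquality
  open import Data.Integer.Tactic.RingSolver

  prime∣*⇒∣⊎∣ : ∀ {x y} → + q ∣ x * y → + q ∣ x ⊎ + q ∣ y
  prime∣*⇒∣⊎∣ {x} {y} q∣xy =
    map ∣ᵤ⇒∣ ∣ᵤ⇒∣ (euclidsLemma (abs x) (abs y) q-prime (subst (q ℕ.∣_) (abs-* x y) (∣⇒∣ᵤ q∣xy)))

  prime∤1 : ¬ + q ∣ 1ℤ
  prime∤1 q∣1 = ¬prime[1] (subst Prime (ℕ.∣1⇒≡1 (∣⇒∣ᵤ q∣1)) q-prime)

  prime∣^⇒∣ : ∀ {x} k → + q ∣ x ^ k → + q ∣ x
  prime∣^⇒∣ zero    q∣1 = ⊥-elim (prime∤1 q∣1)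
  prime∣^⇒∣ (suc k) q∣x^[1+k] = [ (λ q∣x → q∣x) , prime∣^⇒∣ k ]′ (prime∣*⇒∣⊎∣ q∣x^[1+k])

  private
    in-ℤ : ∀ a b c d → 1 ℕ.+ a ℕ.* b ≡ c ℕ.* d → 1ℤ + + a * + b ≡ + c * + d
    in-ℤ a b c d eq =
      trans (cong (λ z → 1ℤ + z) (sym (pos-* a b))) (trans (sym (pos-+ 1 (a ℕ.* b))) (trans (cong +_ eq) (pos-* c d)))

    ℕ-inverse : ∀ {n} → ¬ q ℕ.∣ n → ∃ λ y → + q ∣ + n * y - 1ℤ
    ℕ-inverse {n} q∤n with coprime-Bézout q⊥n
      where
      q⊥n : Coprime q n
      q⊥n (d∣q , d∣n) with prime⇒irreducible q-prime d∣q
      ... | inj₁ d≡1 = d≡1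
      ... | inj₂ refl = ⊥-elim (q∤n d∣n)
    ... | Bézout.+- a b 1+bn≡aq = - + b , divides (- + a) (begin
      + n * - + b - 1ℤ    ≡⟨ by-ring (+ n) (+ b) ⟩
      - (1ℤ + + b * + n)  ≡⟨ cong -_ (in-ℤ b n a q 1+bn≡aq) ⟩
      - (+ a * + q)       ≡⟨ by-ring′ (+ a) (+ q) ⟩
      - + a * + q         ∎)
      where
      open ≡-Reasoning
      by-ring : ∀ n b → n * - b - 1ℤ ≡ - (1ℤ + b * n)
      by-ring = solve-∀
      by-ring′ : ∀ a q → - (a * q) ≡ - a * q
      by-ring′ = solve-∀
    ... | Bézout.-+ a b 1+aq≡bn = + b , divides (+ a) (begin
      + n * + b - 1ℤ          ≡⟨ by-ring (+ n) (+ b) ⟩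
      + b * + n - 1ℤ          ≡⟨ cong (_- 1ℤ) (in-ℤ a q b n 1+aq≡bn) ⟨
      1ℤ + + a * + q - 1ℤ     ≡⟨ by-ring′ (+ a) (+ q) ⟩
      + a * + q               ∎)
      where
      open ≡-Reasoning
      by-ring : ∀ n b → n * b - 1ℤ ≡ b * n - 1ℤ
      by-ring = solve-∀
      by-ring′ : ∀ a q → 1ℤ + a * q - 1ℤ ≡ a * q
      by-ring′ = solve-∀

  inverse : ∀ {x} → ¬ + q ∣ x → ∃ λ y → + q ∣ x * y - 1ℤ
  inverse {+ n}      q∤x = ℕ-inverse (q∤x ∘ ∣ᵤ⇒∣)
  inverse { -[1+ n ] } q∤x with ℕ-inverse (q∤x ∘ ∣ᵤ⇒∣)
  ... | y , q∣ny-1 = - y , subst (+ q ∣_) (by-ring (+ suc n) y) q∣ny-1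
    where by-ring : ∀ n y → n * y - 1ℤ ≡ - n * - y - 1ℤ
          by-ring = solve-∀

module LucasPrimeDivisors (P Q : ℤ) {q : ℕ} (q-prime : Prime q) (q∤Q : ¬ ℤ.+ q Signed.∣ Q) where

  open import Data.Nat as ℕ using (zero; _≤_; _<_; s≤s; z≤n)
  import Data.Nat.Properties as ℕ
  import Data.Nat.Divisibility as ℕ
  open import Data.Nat.DivMod using (_%_; _/_; m≡m%n+[m/n]*n; m%n<n)
  open import Data.Nat.Primality using (prime⇒nonZero)
  open import Data.Integer using (+_; _+_; _*_; _-_; _^_)
  open import Data.Integer.DivMod using (_%ℕ_; n%ℕd<d)
  open import Data.Integer.Divisibility.Signed
  open import Data.Fin using (Fin; toℕ; fromℕ<)
  open import Data.Fin.Properties using (pigeonhole; toℕ-fromℕ<; toℕ<n)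
  open import Data.Product using (∃; ∃₂; _×_; _,_; proj₁; proj₂)
  open import Data.Sum using (inj₁; inj₂; [_,_]′)
  open import Data.Empty using (⊥; ⊥-elim)
  open import Relation.Binary.PropositionalEquality
  open import Data.Integer.Tactic.RingSolver
  open LucasIdentities P Q
  open Congruences
  open IntegerPrime q-prime

  private
    u : ℕ → ℤ
    u = U P Q

    instance
      q-nonZero : ℕ.NonZero q
      q-nonZero = prime⇒nonZero q-prime

  prime∣Q^*⇒∣ : ∀ a {y} → + q ∣ Q ^ a * y → + q ∣ y
  prime∣Q^*⇒∣ a q∣Q^a*y with prime∣*⇒∣⊎∣ q∣Q^a*y
  ... | inj₁ q∣Q^a = ⊥-elim (q∤Q (prime∣^⇒∣ a q∣Q^a))
  ... | inj₂ q∣y   = q∣y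

  ∤U-suc : ∀ m → + q ∣ u m → ¬ + q ∣ u (suc m)
  ∤U-suc zero    _        q∣1      = prime∤1 q∣1
  ∤U-suc (suc m) q∣u[1+m] q∣u[2+m] = ∤U-suc m (prime∣Q^*⇒∣ 1 q∣Q*u[m]) q∣u[1+m]
    where
    by-ring : ∀ P Q a b → P * a - (P * a - Q * b) ≡ Q * + 1 * b
    by-ring = solve-∀
    q∣Q*u[m] : + q ∣ Q ^ 1 * u m
    q∣Q*u[m] = subst (+ q ∣_) (by-ring P Q (u (suc m)) (u m)) (∣m∣n⇒∣m-n (∣n⇒∣m*n P q∣u[1+m]) q∣u[2+m])

  ∣U-cross⇒∣U-∸ : ∀ {k l} → k ≤ l → + q ∣ u l * u (suc k) - u k * u (suc l) → + q ∣ u (l ℕ.∸ k)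
  ∣U-cross⇒∣U-∸ {k} {l} k≤l q∣cross = prime∣Q^*⇒∣ k (subst (+ q ∣_) (U-dOcagne k (l ℕ.∸ k)) q∣cross′)
    where
    q∣cross′ : + q ∣ u (k ℕ.+ (l ℕ.∸ k)) * u (suc k) - u k * u (suc (k ℕ.+ (l ℕ.∸ k)))
    q∣cross′ rewrite ℕ.m+[n∸m]≡n k≤l = q∣cross

  -- Pigeonhole on the q + 1 ratios u(k+1)/u(k) mod q, k = 1, …, q + 1: two of them agree, and
  -- d'Ocagne's identity turns the coincidence into a zero of u mod q at the difference of the indices.
  ∣U-by-1+q : ¬ (∀ k → 1 ≤ k → k ≤ suc q → ¬ + q ∣ u k)
  ∣U-by-1+q ∤U = collision (pigeonhole (ℕ.n<1+n q) ratio)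
    where
    index : Fin (suc q) → ℕ
    index i = suc (toℕ i)
    unit : ∀ i → ¬ + q ∣ u (index i)
    unit i = ∤U (index i) (s≤s z≤n) (toℕ<n i)
    inv : Fin (suc q) → ℤ
    inv i = proj₁ (inverse (unit i))
    ratio : Fin (suc q) → Fin q
    ratio i = fromℕ< (n%ℕd<d (u (suc (index i)) * inv i) q)
    collision : ∃₂ (λ i j → toℕ i < toℕ j × ratio i ≡ ratio j) → ⊥
    collision (i , j , i<j , ratioᵢ≡ratioⱼ) =
      ∤U (index j ℕ.∸ index i) (ℕ.m<n⇒0<n∸m (s≤s i<j)) (ℕ.≤-trans (ℕ.m∸n≤m (toℕ j) (toℕ i)) (ℕ.<⇒≤ (toℕ<n j)))
         (∣U-cross⇒∣U-∸ (s≤s (ℕ.<⇒≤ i<j)) q∣cross)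
      where
      same-residue : (u (suc (index i)) * inv i) %ℕ q ≡ (u (suc (index j)) * inv j) %ℕ q
      same-residue = trans (sym (toℕ-fromℕ< _)) (trans (cong toℕ ratioᵢ≡ratioⱼ) (toℕ-fromℕ< _))
      q∣cross : + q ∣ u (index j) * u (suc (index i)) - u (index i) * u (suc (index j))
      q∣cross = ∣-cross-multiply {x = u (index i)} {y = u (index j)}
        (proj₂ (inverse (unit i))) (proj₂ (inverse (unit j))) (%ℕ-≡⇒∣- (u (suc (index i)) * inv i) _ same-residue)

  rank≤1+q : ∀ {ρ} → (∀ k → 1 ≤ k → k < ρ → ¬ + q ∣ u k) → ρ ≤ suc q
  rank≤1+q ∤U = ℕ.≮⇒≥ λ 1+q<ρ → ∣U-by-1+q λ k 1≤k k≤1+q → ∤U k 1≤k (ℕ.≤-<-trans k≤1+q 1+q<ρ)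

  module _ {ρ : ℕ} (ρ-rank : RankIs P Q q ρ) where

    private
      instance
        ρ-nonZero : ℕ.NonZero ρ
        ρ-nonZero = ℕ.>-nonZero (proj₁ ρ-rank)

    rank∣⇒∣U : ∀ {k} → ρ ℕ.∣ k → + q ∣ u k
    rank∣⇒∣U (ℕ.divides t refl) = ∣-trans (∣ᵤ⇒∣ (proj₁ (proj₂ ρ-rank))) (U-∣-U-* t ρ)

    ∣U⇒rank∣ : ∀ {k} → + q ∣ u k → ρ ℕ.∣ k
    ∣U⇒rank∣ {k} q∣u[k] with k % ρ in k%ρ≡r
    ... | zero   = ℕ.m%n≡0⇒n∣m k ρ k%ρ≡r
    ... | suc r′ = ⊥-elim ([ ∤U-below-rank , ∤U-suc (t ℕ.* ρ) q∣U[tρ] ]′ (prime∣*⇒∣⊎∣ q∣product))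
      where
      t = k / ρ
      k≡ : k ≡ suc (r′ ℕ.+ t ℕ.* ρ)
      k≡ = trans (m≡m%n+[m/n]*n k ρ) (cong (ℕ._+ t ℕ.* ρ) k%ρ≡r)
      ∤U-below-rank : ¬ + q ∣ u (suc r′)
      ∤U-below-rank q∣u =
        proj₂ (proj₂ ρ-rank) (suc r′) (s≤s z≤n) (subst (_< ρ) k%ρ≡r (m%n<n k ρ)) (∣⇒∣ᵤ q∣u)
      q∣U[tρ] : + q ∣ u (t ℕ.* ρ)
      q∣U[tρ] = rank∣⇒∣U (ℕ.n∣m*n t)
      q∣product : + q ∣ u (suc r′) * u (suc (t ℕ.* ρ))
      q∣product = ∣m+n∣n⇒∣m (subst (+ q ∣_) (U-suc-+ r′ (t ℕ.* ρ)) (subst (λ n → + q ∣ u n) k≡ q∣u[k]))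
                            (∣m⇒∣-m (∣n⇒∣m*n (Q * u r′) q∣U[tρ]))

  U-*-cofactor : ∀ {t m} → 1 ≤ t → 1 ≤ m → + q ∣ u m → ¬ q ℕ.∣ t →
                 ∃ λ c → u (t ℕ.* m) ≡ u m * c × ¬ + q ∣ c
  U-*-cofactor {suc t} {suc m} _ _ q∣u[1+m] q∤1+t with U-*-expansion t m
  ... | X , u≡ = _ , u≡ , q∤c
    where
    q∤c : ¬ + q ∣ + suc t * u (suc (suc m)) ^ t + u (suc m) * X
    q∤c q∣c with prime∣*⇒∣⊎∣ {+ suc t} (∣m+n∣n⇒∣m q∣c (∣m⇒∣m*n X q∣u[1+m]))
    ... | inj₁ q∣1+t = q∤1+t (∣⇒∣ᵤ q∣1+t)
    ... | inj₂ q∣u^t = ∤U-suc (suc m) q∣u[1+m] (prime∣^⇒∣ t q∣u^t)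

module LucasValuations (P Q : ℤ) {q : ℕ} (q-prime : Prime q) (q∤Q : ¬ ℤ.+ q Signed.∣ Q)
                       (U≢0 : ∀ n → U P Q (suc n) ≢ ℤ.0ℤ) where

  open import Data.Nat
  open import Data.Nat.Properties
  open import Data.Nat.Divisibility
  open import Data.Nat.Primality using (prime⇒nonZero)
  open import Data.Integer.Properties using (i*j≡0⇒i≡0∨j≡0; ∣i∣≡0⇒i≡0)
  open import Data.Integer.Divisibility.Signed using (∣ᵤ⇒∣)
  open import Data.Product using (_,_; proj₁)
  open import Data.Sum using ([_,_]′)
  open import Function using (_∘_)
  open import Relation.Nullary using (yes; no)
  open import Relation.Binary.PropositionalEquality
  open import Data.Nat.Tactic.RingSolver
  open Valuation q-prime
  open Sums
  open IntegerPrime q-prime using (prime∤1)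
  open LucasPrimeDivisors P Q q-prime q∤Q

  private
    instance
      q-nonZero : NonZero q
      q-nonZero = prime⇒nonZero q-prime

  νU : ℕ → ℕ
  νU k = νℤ (U P Q k)

  νU-* : ∀ {t m} → 1 ≤ t → 1 ≤ m → ℤ.+ q Signed.∣ U P Q m → ¬ q ∣ t → νU (t * m) ≡ νU m
  νU-* {m = suc m} 1≤t 1≤m q∣U[m] q∤t with U-*-cofactor 1≤t 1≤m q∣U[m] q∤t
  ... | c , U≡ , q∤c = trans (cong νℤ U≡) (νℤ-*-∤ (U≢0 m) (q∤c ∘ ∣ᵤ⇒∣))

  ∣U⇒νU≥1 : ∀ {k} → 1 ≤ k → q ∣ ℤ.∣ U P Q k ∣ → 1 ≤ νU k
  ∣U⇒νU≥1 {suc k} _ = ∣⇒ν≥1 (U≢0 k ∘ ∣i∣≡0⇒i≡0)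

  U!≢0 : ∀ m → (m !U) P Q ≢ ℤ.0ℤ
  U!≢0 zero    ()
  U!≢0 (suc m) U[1+m]*m!≡0 = [ U≢0 m , U!≢0 m ]′ (i*j≡0⇒i≡0∨j≡0 (U P Q (suc m)) U[1+m]*m!≡0)

  νℤ-U! : ∀ m → νℤ ((m !U) P Q) ≡ sumTo νU m
  νℤ-U! zero    = ν≡0 (prime∤1 ∘ ∣ᵤ⇒∣)
  νℤ-U! (suc m) = begin
    νℤ (U P Q (suc m) ℤ.* (m !U) P Q)  ≡⟨ νℤ-* (U≢0 m) (U!≢0 m) ⟩
    νU (suc m) + νℤ ((m !U) P Q)       ≡⟨ cong (νU (suc m) +_) (νℤ-U! m) ⟩
    νU (suc m) + sumTo νU m            ≡⟨ +-comm (νU (suc m)) _ ⟩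
    sumTo νU m + νU (suc m)            ∎
    where open ≡-Reasoning

  module _ {ρ : ℕ} (ρ-rank : RankIs P Q q ρ) where

    private
      1≤ρ*q^ : ∀ e → 1 ≤ ρ * q ^ e
      1≤ρ*q^ e = >-nonZero⁻¹ (ρ * q ^ e) {{m*n≢0 ρ (q ^ e) {{>-nonZero (proj₁ ρ-rank)}} {{m^n≢0 q e}}}}

    νU-rank* : ∀ {x} → 1 ≤ x → νU (ρ * x) ≡ νU (ρ * q ^ ν x)
    νU-rank* {x} 1≤x with ν-decomposition (≢-nonZero⁻¹ x {{>-nonZero 1≤x}})
    ... | t , x≡ , q∤t =
      trans (cong νU ρx≡) (νU-* 1≤t (1≤ρ*q^ (ν x)) (rank∣⇒∣U ρ-rank (m∣m*n (q ^ ν x))) q∤t)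
      where
      1≤t : 1 ≤ t
      1≤t = n≢0⇒n>0 λ { refl → q∤t (q ∣0) }
      ρx≡ : ρ * x ≡ t * (ρ * q ^ ν x)
      ρx≡ = trans (cong (ρ *_) x≡) (regroup ρ (q ^ ν x) t)
        where
        regroup : ∀ ρ a t → ρ * (a * t) ≡ t * (ρ * a)
        regroup = solve-∀

    ρ∤⇒νU≡0 : ∀ {k} → ¬ ρ ∣ k → νU k ≡ 0
    ρ∤⇒νU≡0 ρ∤k = ν≡0 (λ q∣U[k] → ρ∤k (∣U⇒rank∣ ρ-rank (∣ᵤ⇒∣ q∣U[k])))

    νU-periodic : ∀ i j {r} → 1 ≤ r → r < ρ * q ^ j → νU (i * (ρ * q ^ j) + r) ≡ νU r
    νU-periodic i j {r} 1≤r r<ρq^j with ρ ∣? r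
    ... | no ρ∤r = trans (ρ∤⇒νU≡0 ρ∤i*ρq^j+r) (sym (ρ∤⇒νU≡0 ρ∤r))
      where
      ρ∤i*ρq^j+r : ¬ ρ ∣ i * (ρ * q ^ j) + r
      ρ∤i*ρq^j+r ρ∣i*ρq^j+r = ρ∤r (∣m+n∣m⇒∣n ρ∣i*ρq^j+r (∣n⇒∣m*n i (m∣m*n (q ^ j))))
    ... | yes (divides r′ refl) = begin
      νU (i * (ρ * q ^ j) + r′ * ρ)        ≡⟨ cong νU (factor i ρ (q ^ j) r′) ⟩
      νU (ρ * (i * q ^ j + r′))            ≡⟨ νU-rank* (≤-trans 1≤r′ (m≤n+m r′ _)) ⟩
      νU (ρ * q ^ ν (i * q ^ j + r′))      ≡⟨ cong (λ e → νU (ρ * q ^ e)) (ν-*q^+ i j 1≤r′ r′<q^j) ⟩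
      νU (ρ * q ^ ν r′)                    ≡⟨ νU-rank* 1≤r′ ⟨
      νU (ρ * r′)                          ≡⟨ cong νU (*-comm ρ r′) ⟩
      νU (r′ * ρ)                          ∎
      where
      open ≡-Reasoning
      factor : ∀ i ρ a r → i * (ρ * a) + r * ρ ≡ ρ * (i * a + r)
      factor = solve-∀
      1≤r′ : 1 ≤ r′
      1≤r′ = n≢0⇒n>0 λ { refl → <⇒≱ 1≤r z≤n }
      r′<q^j : r′ < q ^ j
      r′<q^j = *-cancelˡ-< ρ r′ (q ^ j) (subst (_< ρ * q ^ j) (*-comm r′ ρ) r<ρq^j)

module NonIntegrality where

  open import Data.Nat
  open import Data.Nat.Properties
  open import Data.Nat.Divisibility
  open import Data.Nat.DivMod using (_%_; _/_; m≡m%n+[m/n]*n; m%n<n)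
  open import Data.Nat.Primality using (prime⇒irreducible; ¬prime[1]; prime⇒nonZero)
  open import Data.Integer.Properties using (i^n≡0⇒i≡0)
  open import Data.Integer.Divisibility using () renaming (_∣_ to _∣ℤ_)
  open import Data.Integer.Divisibility.Signed using (∣⇒∣ᵤ)
  open import Data.Product using (proj₁; proj₂)
  open import Data.Sum using (inj₁; inj₂)
  open import Data.Empty using (⊥-elim)
  open import Function using (_∘_)
  open import Relation.Binary.PropositionalEquality
  open import Data.Nat.Tactic.RingSolver
  open Sums

  consecutive-primes : ∀ {n} → Prime n → Prime (suc n) → n ≡ 2
  consecutive-primes {n} n-prime 1+n-prime with n % 2 | m≡m%n+[m/n]*n n 2 | m%n<n n 2
  ... | zero | n≡ | _ with prime⇒irreducible n-prime (divides (n / 2) n≡)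
  ...   | inj₁ ()
  ...   | inj₂ 2≡n = sym 2≡n
  consecutive-primes {n} n-prime 1+n-prime | suc zero | n≡ | _
    with prime⇒irreducible 1+n-prime (divides (suc (n / 2)) (cong suc n≡))
  ...   | inj₁ ()
  ...   | inj₂ 2≡1+n = ⊥-elim (¬prime[1] (subst Prime (cong pred (sym 2≡1+n)) n-prime))
  consecutive-primes n-prime 1+n-prime | suc (suc _) | _ | s≤s (s≤s ())

  module Setting {P Q : ℤ} (reg : ΔRegular P Q)
                 {p : ℕ} (p-prime : Prime p) (p>3 : p > 3) (p-rank : RankIs P Q p (p + 1))
                 {q : ℕ} (q-prime : Prime q) (q∤Q : ¬ ℤ.+ q ∣ℤ Q) (q-rank : RankIs P Q q p) where

    private
      U≢0 : ∀ n → U P Q (suc n) ≢ ℤ.0ℤ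
      U≢0 = proj₁ (proj₂ (proj₂ reg))

      1≤p : 1 ≤ p
      1≤p = ≤-trans (s≤s z≤n) p>3

      1≤p+2 : 1 ≤ p + 2
      1≤p+2 = ≤-trans 1≤p (m≤m+n p 2)

      instance
        q-nonZero : NonZero q
        q-nonZero = prime⇒nonZero q-prime

      1≤*q^ : ∀ {a} e → 1 ≤ a → 1 ≤ a * q ^ e
      1≤*q^ {a} e 1≤a = >-nonZero⁻¹ (a * q ^ e) {{m*n≢0 a (q ^ e) {{>-nonZero 1≤a}} {{m^n≢0 q e}}}}

    open Valuation q-prime
    open LucasPrimeDivisors P Q q-prime (q∤Q ∘ ∣⇒∣ᵤ)
    open LucasValuations P Q q-prime (q∤Q ∘ ∣⇒∣ᵤ) U≢0

    2+p≤q : 2 + p ≤ q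
    2+p≤q = ≤∧≢⇒< (≤∧≢⇒< p≤q p≢q) 1+p≢q
      where
      p≢1+q : p ≢ suc q
      p≢1+q p≡1+q = <⇒≢ p>3 (sym (trans p≡1+q (cong suc (consecutive-primes q-prime (subst Prime p≡1+q p-prime)))))
      p≤q : p ≤ q
      p≤q = ≤-pred (≤∧≢⇒< (rank≤1+q λ k 1≤k k<p → proj₂ (proj₂ q-rank) k 1≤k k<p ∘ ∣⇒∣ᵤ) p≢1+q)
      p≢q : p ≢ q
      p≢q refl = proj₂ (proj₂ p-rank) p 1≤p (m<m+n p z<s) (proj₁ (proj₂ q-rank))
      1+p≢q : suc p ≢ q
      1+p≢q refl = <⇒≢ (<⇒≤ p>3) (sym (consecutive-primes p-prime q-prime))

    q∤≤1+p : ∀ {i} → 1 ≤ i → i ≤ suc p → ¬ q ∣ i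
    q∤≤1+p 1≤i i≤1+p q∣i = <⇒≱ (≤-<-trans i≤1+p 2+p≤q) (∣⇒≤ {{>-nonZero 1≤i}} q∣i)

    q∤[p+2]*q^j∸1 : ∀ j → ¬ q ∣ (p + 2) * q ^ j ∸ 1
    q∤[p+2]*q^j∸1 zero = subst (λ y → ¬ q ∣ y) (sym y≡1+p) (q∤≤1+p (s≤s z≤n) ≤-refl)
      where
      y≡1+p : (p + 2) * 1 ∸ 1 ≡ suc p
      y≡1+p = trans (cong (_∸ 1) (*-identityʳ (p + 2))) (trans (+-∸-assoc p (s≤s z≤n)) (+-comm p 1))
    q∤[p+2]*q^j∸1 (suc j) q∣y = q∤1 (∣m+n∣m⇒∣n q∣y+1 q∣y)
      where
      y = (p + 2) * q ^ suc j ∸ 1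
      q∣y+1 : q ∣ y + 1
      q∣y+1 = subst (q ∣_) (trans (sym (m+[n∸m]≡n (1≤*q^ (suc j) 1≤p+2))) (+-comm 1 y))
                           (∣n⇒∣m*n (p + 2) (m∣m*n (q ^ j)))

    module _ (j : ℕ) where

      N n y : ℕ
      N = p * q ^ j
      n = N ∸ 1
      y = (p + 2) * q ^ j ∸ 1

      1+n≡N : suc n ≡ N
      1+n≡N = m+[n∸m]≡n (1≤*q^ j 1≤p)

      νU[i*N+r]≡νU[r] : ∀ i r → i < p + 1 → 1 ≤ r → r ≤ N → νU (i * N + r) ≡ νU r
      νU[i*N+r]≡νU[r] i r i<p+1 1≤r r≤N with m≤n⇒m<n∨m≡n r≤N
      ... | inj₁ r<N  = νU-periodic q-rank i j 1≤r r<N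
      ... | inj₂ refl = trans (cong νU (+-comm (i * N) N))
        (νU-* (s≤s z≤n) (1≤*q^ j 1≤p) (rank∣⇒∣U q-rank (m∣m*n (q ^ j)))
              (q∤≤1+p (s≤s z≤n) (subst (suc i ≤_) (+-comm p 1) i<p+1)))

      νℤ-CDen≡sumTo : νℤ (CDen P Q p n) ≡ sumTo νU ((p + 1) * N + n)
      νℤ-CDen≡sumTo = begin
        νℤ (U P Q (suc n) ℤ.^ (p + 1) ℤ.* (n !U) P Q ℤ.^ (p + 2))
          ≡⟨ νℤ-* (U≢0 n ∘ i^n≡0⇒i≡0 _ (p + 1)) (U!≢0 n ∘ i^n≡0⇒i≡0 _ (p + 2)) ⟩
        νℤ (U P Q (suc n) ℤ.^ (p + 1)) + νℤ ((n !U) P Q ℤ.^ (p + 2))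
          ≡⟨ cong₂ _+_ (νℤ-^ (p + 1) (U≢0 n))
                       (trans (νℤ-^ (p + 2) (U!≢0 n)) (cong ((p + 2) *_) (νℤ-U! n))) ⟩
        (p + 1) * νU (suc n) + (p + 2) * sumTo νU n
          ≡⟨ regroup p (sumTo νU n) (νU (suc n)) ⟨
        (p + 1) * sumTo νU (suc n) + sumTo νU n
          ≡⟨ cong (λ m → (p + 1) * sumTo νU m + sumTo νU n) 1+n≡N ⟩
        (p + 1) * sumTo νU N + sumTo νU n
          ≡⟨ cong₂ _+_ (sumTo-periodic νU N (p + 1) νU[i*N+r]≡νU[r] (p + 1) ≤-refl)
                       (sumTo-cong n λ r 1≤r r≤n →
                          νU-periodic q-rank (p + 1) j 1≤r (subst (r <_) 1+n≡N (s≤s r≤n))) ⟨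
        sumTo νU ((p + 1) * N) + sumTo (λ r → νU ((p + 1) * N + r)) n
          ≡⟨ sumTo-+ νU ((p + 1) * N) n ⟨
        sumTo νU ((p + 1) * N + n) ∎
        where
        open ≡-Reasoning
        regroup : ∀ p s g → (p + 1) * (s + g) + s ≡ (p + 1) * g + (p + 2) * s
        regroup = solve-∀

      2+[p+2]*n≡p*y : 2 + (p + 2) * n ≡ p * y
      2+[p+2]*n≡p*y = +-cancelʳ-≡ p _ _ (begin
        2 + (p + 2) * n + p      ≡⟨ regroup p n ⟩
        (p + 2) * suc n          ≡⟨ cong ((p + 2) *_) 1+n≡N ⟩
        (p + 2) * (p * q ^ j)    ≡⟨ commute p (q ^ j) ⟩
        p * ((p + 2) * q ^ j)    ≡⟨ cong (p *_) (m+[n∸m]≡n (1≤*q^ j 1≤p+2)) ⟨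
        p * suc y                ≡⟨ *-suc p y ⟩
        p + p * y                ≡⟨ +-comm p (p * y) ⟩
        p * y + p                ∎)
        where
        open ≡-Reasoning
        regroup : ∀ p n → 2 + (p + 2) * n + p ≡ (p + 2) * (1 + n)
        regroup = solve-∀
        commute : ∀ p a → (p + 2) * (p * a) ≡ p * ((p + 2) * a)
        commute = solve-∀

      νU[2+[p+2]*n]≥1 : 1 ≤ νU (2 + (p + 2) * n)
      νU[2+[p+2]*n]≥1 = subst (1 ≤_) (sym νU[p*y]≡νU[p]) (∣U⇒νU≥1 1≤p (proj₁ (proj₂ q-rank)))
        where
        1≤y : 1 ≤ y
        1≤y = n≢0⇒n>0 λ y≡0 → q∤[p+2]*q^j∸1 j (subst (q ∣_) (sym y≡0) (q ∣0))
        νU[p*y]≡νU[p] : νU (2 + (p + 2) * n) ≡ νU p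
        νU[p*y]≡νU[p] = begin
          νU (2 + (p + 2) * n)  ≡⟨ cong νU 2+[p+2]*n≡p*y ⟩
          νU (p * y)            ≡⟨ νU-rank* q-rank 1≤y ⟩
          νU (p * q ^ ν y)      ≡⟨ cong (λ e → νU (p * q ^ e)) (ν≡0 (q∤[p+2]*q^j∸1 j)) ⟩
          νU (p * 1)            ≡⟨ cong νU (*-identityʳ p) ⟩
          νU p                  ∎
          where open ≡-Reasoning

      CNum≢0 : CNum P Q p n ≢ ℤ.0ℤ
      CNum≢0 = U!≢0 ((p + 2) * n)

      νℤ-CNum<νℤ-CDen : νℤ (CNum P Q p n) < νℤ (CDen P Q p n)
      νℤ-CNum<νℤ-CDen = begin-strict
        νℤ (CNum P Q p n)              ≡⟨ νℤ-U! M ⟩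
        sumTo νU M                     <⟨ m<m+n (sumTo νU M) νU[2+[p+2]*n]≥1 ⟩
        sumTo νU M + νU (2 + M)        ≤⟨ +-monoˡ-≤ (νU (2 + M)) (m≤m+n (sumTo νU M) (νU (suc M))) ⟩
        sumTo νU (2 + M)               ≤⟨ sumTo-mono-≤ νU 2+M≤L ⟩
        sumTo νU ((p + 1) * N + n)     ≡⟨ νℤ-CDen≡sumTo ⟨
        νℤ (CDen P Q p n)              ∎
        where
        open ≤-Reasoning
        M = (p + 2) * n
        2+M≤L : 2 + M ≤ (p + 1) * N + n
        2+M≤L = begin
          2 + M                ≤⟨ +-monoˡ-≤ M (s≤s 1≤p) ⟩
          suc p + M            ≡⟨ expand p n ⟩
          (p + 1) * suc n + n  ≡⟨ cong (λ m → (p + 1) * m + n) 1+n≡N ⟩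
          (p + 1) * N + n      ∎
          where
          expand : ∀ p n → suc p + (p + 2) * n ≡ (p + 1) * suc n + n
          expand = solve-∀

open import Data.Nat using (ℕ; _+_; _*_; _∸_; _^_; _>_)
open import Data.Nat.Properties using (<⇒≱)
open import Data.Integer using (ℤ; +_)
open import Data.Integer.Divisibility using (_∣_)

proposition21 : (P Q : ℤ) → ΔRegular P Q →
    (p : ℕ) → Prime p → p > 3 → ¬ ((+ p) ∣ Q) → RankIs P Q p (p + 1) →
    (q : ℕ) → Prime q → ¬ ((+ q) ∣ Q) → RankIs P Q q p →
    (j : ℕ) → ¬ CIsInteger P Q p (p * q ^ j ∸ 1)
proposition21 P Q reg p p-prime p>3 _ p-rank q q-prime q∤Q q-rank j den∣num =
  <⇒≱ (νℤ-CNum<νℤ-CDen j) (νℤ-mono-∣ (CDen P Q p (p * q ^ j ∸ 1)) den∣num (CNum≢0 j))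
  where
  open NonIntegrality.Setting reg p-prime p>3 p-rank q-prime q∤Q q-rank
  open Valuation q-prime using (νℤ-mono-∣)
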